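{- (Completeness of the liability fragment of CL.) Every valid formula of $\Phi_{\mathsf{CL}_{LI}}$ is derivable in the axiomatic system $\mathsf{CL}_{LI}$ described in the context.
   Context: Fix a nonempty finite set $Ag$ of agents and a countable set $AP$ of atoms. A coalition is a subset of $Ag$. For a nonempty set $Ac$ of actions and coalition $A$, a joint action of $A$ is a function $A\to Ac$; $JA_A$ denotes the set of these. A concurrent game model is $M=(St,Ac,av,out,L)$: $St$ nonempty set of states; $Ac$ nonempty set of actions; $av(s,A)\subseteq JA_A$ nonempty for each $s,A$, with $av(s,A)=\{\bigcup_{a\in A}\sigma_a\mid\sigma_a\in av(s,\{a\})\}$ for $A\neq\emptyset$ and $av(s,\emptyset)=\{\emptyset\}$; $out(s,\sigma)$ for $\sigma\in JA_A$ is $\emptyset$ if $\sigma\notin av(s,A)$, a singleton if $A=Ag$ and $\sigma\in av(s,Ag)$, and $\bigcup\{out(s,\sigma')\mid\sigma'\in av(s,Ag),\sigma\subseteq\sigma'\}$ if $A\ne Ag$ and $\sigma\in av(s,A)$; $L:St\to\mathcal P(AP)$. Coalition Logic: $\phi::=p\mid\top\mid\neg\phi\mid\phi\wedge\phi\mid\langle A\rangle\phi$, booleans standard, $M,s\models\langle A\rangle\phi$ iff there is $\sigma_A\in av(s,A)$ with $M,t\models\phi$ for all $t\in out(s,\sigma_A)$; $[A]\phi:=\neg\langle A\rangle\neg\phi$. Valid = true at every pointed model $(M,s)$. $\Phi_{\mathsf{CL}_{LI}}$: $\phi::=\top\mid\bot\mid p\mid\neg p\mid(\phi\wedge\phi)\mid(\phi\vee\phi)\mid[A]\phi$.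 System $\mathsf{CL}_{LI}$: axioms are the propositional tautologies in $\Phi_{\mathsf{CL}_{LI}}$; rules: R1: from $\phi_1,\dots,\phi_n$ infer $\psi$ where $(\phi_1\wedge\dots\wedge\phi_n)\to\psi$ is a propositional tautology; R2: from $\phi$ infer $[A]\phi$; R3: from $[A\cup B](\phi\vee\psi)\vee\chi$ infer $[A]\phi\vee[B]\psi\vee\chi$, where $A\cap B=\emptyset$. -}

module Defs where

open import Data.Nat using (ℕ; suc)
open import Data.Fin using (Fin)
open import Data.Fin.Subset using (Subset; _∈_; _∪_)
open import Data.Bool using (Bool; true; false; not; _∧_; _∨_)
open import Data.Product using (Σ; ∃; _×_; _,_)
open import Data.Unit using (⊤)
open import Data.Empty using (⊥)
open import Relation.Nullary using (¬_)
open import Relation.Binary.PropositionalEquality using (_≡_)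

Agent : ℕ → Set
Agent n = Fin (suc n)

Coalition : ℕ → Set
Coalition n = Subset (suc n)

Disjoint : ∀ {n} → Coalition n → Coalition n → Set
Disjoint {n} A B = (a : Agent n) → a ∈ A → a ∈ B → ⊥

-- The model is given by its primitive data: the individual availability
-- av(s,{a}) (a subset of Ac, identified with joint actions of {a}), and
-- the outcome of complete joint actions.  av(s,A) and out(s,σ) for
-- arbitrary coalitions are then *defined* exactly as in the paper.

record CGM (n : ℕ) (AP : Set) : Set₁ where
  field
    St    : Set
    st₀   : St
    Ac    : Set
    ac₀   : Ac
    avail : St → Agent n → Ac → Set
    avail-nonempty : (s : St) (a : Agent n) → Σ Ac (avail s a)
    next  : St → (Agent n → Ac) → St          -- out(s,σ) = {next s σ} for σ ∈ av(s,Ag)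
    L     : St → AP → Bool

  JA : Coalition n → Set
  JA A = (a : Agent n) → a ∈ A → Ac

  -- σ ∈ av(s,A)  (A = ∅ gives av(s,∅) = {∅})
  Av : St → (A : Coalition n) → JA A → Set
  Av s A σ = (a : Agent n) (h : a ∈ A) → avail s a (σ a h)

  Out : St → (A : Coalition n) → JA A → St → Set
  Out s A σ t = Σ (Agent n → Ac) λ σ' →
                  ((a : Agent n) → avail s a (σ' a))
                × ((a : Agent n) (h : a ∈ A) → σ' a ≡ σ a h)
                × (t ≡ next s σ')

data CL (n : ℕ) (AP : Set) : Set where
  atom : AP → CL n AP
  top  : CL n AP
  neg  : CL n AP → CL n AP
  and  : CL n AP → CL n AP → CL n AP
  dia  : Coalition n → CL n AP → CL n AP

module _ {n : ℕ} {AP : Set} where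

  _,_⊨_ : (M : CGM n AP) → CGM.St M → CL n AP → Set
  M , s ⊨ atom p  = CGM.L M s p ≡ true
  M , s ⊨ top     = ⊤
  M , s ⊨ neg φ   = ¬ (M , s ⊨ φ)
  M , s ⊨ and φ ψ = (M , s ⊨ φ) × (M , s ⊨ ψ)
  M , s ⊨ dia A φ = Σ (CGM.JA M A) λ σ →
                      CGM.Av M s A σ
                    × ((t : CGM.St M) → CGM.Out M s A σ t → M , t ⊨ φ)

data LI (n : ℕ) (AP : Set) : Set where
  ⊤'   : LI n AP
  ⊥'   : LI n AP
  var  : AP → LI n AP
  nvar : AP → LI n AP
  _∧'_ : LI n AP → LI n AP → LI n AP
  _∨'_ : LI n AP → LI n AP → LI n AP
  box  : Coalition n → LI n AP → LI n AP

infixr 6 _∧'_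
infixr 5 _∨'_

embed : ∀ {n AP} → LI n AP → CL n AP
embed ⊤'        = top
embed ⊥'        = neg top
embed (var p)   = atom p
embed (nvar p)  = neg (atom p)
embed (φ ∧' ψ)  = and (embed φ) (embed ψ)
embed (φ ∨' ψ)  = neg (and (neg (embed φ)) (neg (embed ψ)))
embed (box A φ) = neg (dia A (neg (embed φ)))

Valid : ∀ {n AP} → LI n AP → Set₁
Valid {n} {AP} φ = (M : CGM n AP) (s : CGM.St M) → M , s ⊨ embed φ

-- Propositional tautologies: propositional atoms are the atoms p and the
-- boxed formulas [A]ψ; a valuation assigns a truth value to each.

record PVal (n : ℕ) (AP : Set) : Set where
  field
    vatom : AP → Bool
    vbox  : Coalition n → LI n AP → Bool

peval : ∀ {n AP} → PVal n AP → LI n AP → Bool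
peval v ⊤'        = true
peval v ⊥'        = false
peval v (var p)   = PVal.vatom v p
peval v (nvar p)  = not (PVal.vatom v p)
peval v (φ ∧' ψ)  = peval v φ ∧ peval v ψ
peval v (φ ∨' ψ)  = peval v φ ∨ peval v ψ
peval v (box A φ) = PVal.vbox v A φ

Tautology : ∀ {n AP} → LI n AP → Set
Tautology {n} {AP} φ = (v : PVal n AP) → peval v φ ≡ true

TautImp : ∀ {n AP} {k : ℕ} → (Fin k → LI n AP) → LI n AP → Set
TautImp {n} {AP} {k} Γ ψ =
  (v : PVal n AP) → ((i : Fin k) → peval v (Γ i) ≡ true) → peval v ψ ≡ true

data ⊢_ {n : ℕ} {AP : Set} : LI n AP → Set where
  axiom : {φ : LI n AP} → Tautology φ → ⊢ φ
  R1    : {k : ℕ} (Γ : Fin k → LI n AP) {ψ : LI n AP} →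
          ((i : Fin k) → ⊢ Γ i) → TautImp Γ ψ → ⊢ ψ
  R2    : (A : Coalition n) {φ : LI n AP} → ⊢ φ → ⊢ box A φ
  R3    : (A B : Coalition n) {φ ψ χ : LI n AP} → Disjoint A B →
          ⊢ (box (A ∪ B) (φ ∨' ψ) ∨' χ) →
          ⊢ (box A φ ∨' (box B ψ ∨' χ))

infix 2 ⊢_

-- If φ is not derivable we build a tree-shaped countermodel, by induction on modal
-- depth. Put φ in conjunctive normal form; φ is derivable iff each clause is. A
-- clause is derivable if it contains both p and ¬p, or if for some pairwise disjoint
-- family [A₁]ψ₁, …, [Aₘ]ψₘ of its boxes the shallower formula ψ₁ ∨ … ∨ ψₘ is
-- derivable: R2 gives [A₁ ∪ … ∪ Aₘ](ψ₁ ∨ … ∨ ψₘ), which m − 1 uses of R3 split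
-- into the boxes. Otherwise, by induction, every such family has a tree refuting all
-- of its ψᵢ. The root of the countermodel falsifies the literals of the clause, lets
-- the coalition of the i-th box play i, and sends a complete joint action σ to the
-- tree of the family of boxes whose coalitions all play their own index; this family
-- is pairwise disjoint because an agent plays only one index.

module Submission where

open import Defs
open import Data.Nat as ℕ using (ℕ; zero; suc; _+_; _≤_; _<_; _⊔_; z≤n; s≤s⁻¹)
open import Data.Nat.Properties
  using (≤-refl; m≤n⇒m≤1+n; n≮n; +-identityʳ; +-suc; ⊔-lub; m⊔n≤o⇒m≤o; m⊔n≤o⇒n≤o)
open import Data.Fin as Fin using (toℕ)
open import Data.Fin.Properties using (all?)
open import Data.Fin.Subset using (_∪_) renaming (_∈_ to _∈ₛ_)
open import Data.Fin.Subset.Properties using (x∈p∪q⁻) renaming (_∈?_ to _∈ₛ?_)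
open import Data.Bool using (Bool; true; false; not; _∧_; _∨_)
open import Data.Bool.Properties
  using (∨-assoc; ∧-assoc; ∨-zeroʳ; ∨-identityʳ; ∧-identityʳ; ∨-distribˡ-∧; ∨-distribʳ-∧)
open import Data.Product as Product using (Σ; ∃; _×_; _,_; proj₁; proj₂)
open import Data.Sum as Sum using (_⊎_; inj₁; inj₂; [_,_]′; fromInj₁)
open import Data.Unit using (⊤; tt)
open import Data.Empty using (⊥; ⊥-elim)
open import Data.List using (List; []; _∷_; _++_; [_]; map; foldr; cartesianProductWith)
open import Data.List.Properties using (map-++; ++-identityʳ)
open import Data.List.Relation.Unary.All as All using (All; []; _∷_)
import Data.List.Relation.Unary.All.Properties as All
open import Data.List.Relation.Unary.Any as Any using (Any; here; there; any?)
import Data.List.Relation.Unary.Any.Properties as Any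
open import Data.List.Relation.Unary.AllPairs using (AllPairs; []; _∷_; allPairs?)
open import Data.List.Membership.Propositional using (_∈_; find; lose)
open import Data.List.Membership.Propositional.Properties using (∈-map⁺; ∈-map⁻)
open import Data.List.Relation.Binary.Subset.Propositional using (_⊆_)
open import Data.List.Relation.Binary.Subset.Propositional.Properties
  using (⊆-reflexive; ⊆-trans; ⊆-reflexive-↭; Any-resp-⊆)
open import Data.List.Relation.Binary.Sublist.Propositional
  using ([]; _∷_; _∷ʳ_) renaming (_⊆_ to _⊑_; lookup to ⊑-lookup)
open import Data.List.Relation.Binary.Permutation.Propositional using (swap; ↭-refl)
open import Data.List.Relation.Binary.Permutation.Propositional.Properties using (shift)
open import Function using (_∘_; id)
open import Function.Bundles using (_↣_)
open import Relation.Nullary using (¬_; Dec; yes; no; does; contradiction)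
open import Relation.Nullary.Decidable
  using (dec-true; dec-false; via-injection; map′; _→-dec_)
open import Relation.Unary using (Decidable)
open import Relation.Binary.Definitions using (DecidableEquality)
open import Relation.Binary.PropositionalEquality
  using (_≡_; refl; sym; trans; cong; cong₂; subst; module ≡-Reasoning)

all⊎any : ∀ {X : Set} {P Q R : X → Set} {xs} →
          (∀ {x} → P x → Q x ⊎ R x) → All P xs → All Q xs ⊎ Any R xs
all⊎any f []         = inj₁ []
all⊎any f (px ∷ pxs) =
  [ (λ qx → Sum.map (qx ∷_) there (all⊎any f pxs)) , inj₂ ∘ here ]′ (f px)

All-cartesianProductWith-++⁺ : ∀ {X : Set} {P : X → Set} {xss yss : List (List X)} →
  All (All P) xss → All (All P) yss → All (All P) (cartesianProductWith _++_ xss yss)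
All-cartesianProductWith-++⁺ []           _    = []
All-cartesianProductWith-++⁺ (pxs ∷ pxss) pyss =
  All.++⁺ (All.map⁺ (All.map (All.++⁺ pxs) pyss)) (All-cartesianProductWith-++⁺ pxss pyss)

all-sublists⊎ : ∀ {X : Set} {P : List X → Set} {Q : Set} (xs : List X) →
                (∀ {ys} → ys ⊑ xs → P ys ⊎ Q) → (∀ {ys} → ys ⊑ xs → P ys) ⊎ Q
all-sublists⊎ [] try with try []
... | inj₁ p = inj₁ λ { [] → p }
... | inj₂ q = inj₂ q
all-sublists⊎ {P = P} (x ∷ xs) try
  with all-sublists⊎ xs (λ τ → try (x ∷ʳ τ))
     | all-sublists⊎ {P = P ∘ (x ∷_)} xs (λ τ → try (refl ∷ τ))
... | inj₂ q    | _         = inj₂ q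
... | inj₁ _    | inj₂ q    = inj₂ q
... | inj₁ skip | inj₁ keep =
  inj₁ λ { (_ ∷ʳ τ) → skip τ ; (refl ∷ τ) → keep τ }

module Completeness (n : ℕ) {AP : Set} (_≟_ : DecidableEquality AP) where

  private
    Formula = LI n AP

  ⋁ ⋀ : List Formula → Formula
  ⋁ = foldr _∨'_ ⊥'
  ⋀ = foldr _∧'_ ⊤'

  _⊨ₚ_ : Formula → Formula → Set
  φ ⊨ₚ ψ = (v : PVal n AP) → peval v φ ≡ true → peval v ψ ≡ true

  ⊢-mono : ∀ {φ ψ : Formula} → φ ⊨ₚ ψ → ⊢ φ → ⊢ ψ
  ⊢-mono {φ} φ⊨ψ ⊢φ =
    R1 {k = 1} (λ _ → φ) (λ _ → ⊢φ) (λ v ⊨φ → φ⊨ψ v (⊨φ Fin.zero))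

  ⊢-∧ : ∀ {φ ψ : Formula} → ⊢ φ → ⊢ ψ → ⊢ φ ∧' ψ
  ⊢-∧ {φ} {ψ} ⊢φ ⊢ψ =
    R1 {k = 2} (λ { Fin.zero → φ ; (Fin.suc _) → ψ })
               (λ { Fin.zero → ⊢φ ; (Fin.suc _) → ⊢ψ })
               (λ v ⊨φψ → cong₂ _∧_ (⊨φψ Fin.zero) (⊨φψ (Fin.suc Fin.zero)))

  ⊢-⋀ : ∀ {Γ : List Formula} → All ⊢_ Γ → ⊢ ⋀ Γ
  ⊢-⋀ []         = axiom λ _ → refl
  ⊢-⋀ (⊢φ ∷ ⊢Γ) = ⊢-∧ ⊢φ (⊢-⋀ ⊢Γ)

  module _ (v : PVal n AP) where

    ⋁-true⁺ : ∀ {Γ} → Any (λ φ → peval v φ ≡ true) Γ → peval v (⋁ Γ) ≡ true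
    ⋁-true⁺ (here φ≡true) rewrite φ≡true = refl
    ⋁-true⁺ {φ ∷ _} (there Γ-true) rewrite ⋁-true⁺ Γ-true = ∨-zeroʳ (peval v φ)

    ⋁-true⁻ : ∀ Γ → peval v (⋁ Γ) ≡ true → Any (λ φ → peval v φ ≡ true) Γ
    ⋁-true⁻ (φ ∷ Γ) ⋁≡true with peval v φ in φ≡
    ... | true  = here φ≡
    ... | false = there (⋁-true⁻ Γ ⋁≡true)

    ⋁-++ : ∀ Γ Δ → peval v (⋁ (Γ ++ Δ)) ≡ peval v (⋁ Γ) ∨ peval v (⋁ Δ)
    ⋁-++ []      Δ = refl
    ⋁-++ (φ ∷ Γ) Δ =
      trans (cong (peval v φ ∨_) (⋁-++ Γ Δ)) (sym (∨-assoc (peval v φ) _ _))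

    ⋀-++ : ∀ Γ Δ → peval v (⋀ (Γ ++ Δ)) ≡ peval v (⋀ Γ) ∧ peval v (⋀ Δ)
    ⋀-++ []      Δ = refl
    ⋀-++ (φ ∷ Γ) Δ =
      trans (cong (peval v φ ∧_) (⋀-++ Γ Δ)) (sym (∧-assoc (peval v φ) _ _))

  ⊢-⋁⁺ : ∀ {φ} {Γ : List Formula} → φ ∈ Γ → ⊢ φ → ⊢ ⋁ Γ
  ⊢-⋁⁺ φ∈Γ = ⊢-mono λ v → ⋁-true⁺ v ∘ lose φ∈Γ

  ⊢-⋁-⊆ : ∀ {Γ Δ : List Formula} → Γ ⊆ Δ → ⊢ ⋁ Γ → ⊢ ⋁ Δ
  ⊢-⋁-⊆ {Γ} Γ⊆Δ = ⊢-mono λ v → ⋁-true⁺ v ∘ Any-resp-⊆ Γ⊆Δ ∘ ⋁-true⁻ v Γ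

  -- Iterated R3

  infix 4 _▸_
  record Box : Set where
    constructor _▸_
    field
      coalition : Coalition n
      body      : Formula

  open Box

  boxed : Box → Formula
  boxed (A ▸ ψ) = box A ψ

  merge : Box → List Box → Box
  merge b []        = b
  merge b (b′ ∷ bs) =
    coalition b ∪ coalition (merge b′ bs) ▸ body b ∨' body (merge b′ bs)

  PairwiseDisjoint : List Box → Set
  PairwiseDisjoint = AllPairs (λ b b′ → Disjoint (coalition b) (coalition b′))

  disjoint-merge : ∀ {A b bs} →
    All (Disjoint A ∘ coalition) (b ∷ bs) → Disjoint A (coalition (merge b bs))
  disjoint-merge {bs = []}    (A#b ∷ [])   = A#b
  disjoint-merge {bs = _ ∷ _} (A#b ∷ A#bs) a a∈A a∈∪ =
    [ A#b a a∈A , disjoint-merge A#bs a a∈A ]′ (x∈p∪q⁻ _ _ a∈∪)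

  -- Each step applies R3 to the first box and rotates the merged rest to the front.
  ⊢-unmerge : ∀ b bs Δ → PairwiseDisjoint (b ∷ bs) →
              ⊢ ⋁ (boxed (merge b bs) ∷ Δ) → ⊢ ⋁ (map boxed (b ∷ bs) ++ Δ)
  ⊢-unmerge b []        Δ _              ⊢merged = ⊢merged
  ⊢-unmerge b (b′ ∷ bs) Δ (b#bs ∷ bs#bs) ⊢merged =
    ⊢-⋁-⊆ (⊆-reflexive-↭ (shift (boxed b) (map boxed (b′ ∷ bs)) Δ))
      (⊢-unmerge b′ bs (boxed b ∷ Δ) bs#bs
        (⊢-⋁-⊆ (⊆-reflexive-↭ (swap (boxed b) (boxed (merge b′ bs)) (↭-refl {x = Δ})))
          (R3 (coalition b) _ (disjoint-merge b#bs) ⊢merged)))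

  depth : Formula → ℕ
  depth (φ ∧' ψ)  = depth φ ⊔ depth ψ
  depth (φ ∨' ψ)  = depth φ ⊔ depth ψ
  depth (box _ φ) = suc (depth φ)
  depth _         = 0

  depth-merge : ∀ {d} b bs →
    All (λ b → depth (body b) ≤ d) (b ∷ bs) → depth (body (merge b bs)) ≤ d
  depth-merge b []        (≤d ∷ [])  = ≤d
  depth-merge b (b′ ∷ bs) (≤d ∷ ≤ds) = ⊔-lub ≤d (depth-merge b′ bs ≤ds)

  -- The tree model

  data Tree : Set where
    leaf : Tree
    node : (AP → Bool) → ((Agent n → ℕ) → Tree) → Tree

  label : Tree → AP → Bool
  label leaf       _ = false
  label (node ℓ _)   = ℓ

  successor : Tree → (Agent n → ℕ) → Tree
  successor leaf       _ = leaf
  successor (node _ f)   = f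

  treeModel : CGM n AP
  treeModel = record
    { St = Tree ; st₀ = leaf ; Ac = ℕ ; ac₀ = 0
    ; avail = λ _ _ _ → ⊤ ; avail-nonempty = λ _ _ → 0 , tt
    ; next = successor ; L = label
    }

  Refuted : Tree → Formula → Set
  Refuted t ⊤'        = ⊥
  Refuted t ⊥'        = ⊤
  Refuted t (var p)   = label t p ≡ false
  Refuted t (nvar p)  = label t p ≡ true
  Refuted t (φ ∧' ψ)  = Refuted t φ ⊎ Refuted t ψ
  Refuted t (φ ∨' ψ)  = Refuted t φ × Refuted t ψ
  Refuted t (box A φ) =
    Σ ((a : Agent n) → a ∈ₛ A → ℕ) λ σ →
      ∀ σ′ → (∀ a (a∈A : a ∈ₛ A) → σ′ a ≡ σ a a∈A) → Refuted (successor t σ′) φ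

  refuted⇒¬⊨ : ∀ {t} φ → Refuted t φ → ¬ (treeModel , t ⊨ embed φ)
  refuted⇒¬⊨ ⊤'        ()
  refuted⇒¬⊨ ⊥'        _            ⊨⊥       = ⊨⊥ tt
  refuted⇒¬⊨ (var p)   p≡false      p≡true   = contradiction (trans (sym p≡false) p≡true) λ ()
  refuted⇒¬⊨ (nvar p)  p≡true       ⊨¬p      = ⊨¬p p≡true
  refuted⇒¬⊨ (φ ∧' ψ)  (inj₁ r)     (⊨φ , _) = refuted⇒¬⊨ φ r ⊨φ
  refuted⇒¬⊨ (φ ∧' ψ)  (inj₂ r)     (_ , ⊨ψ) = refuted⇒¬⊨ ψ r ⊨ψ
  refuted⇒¬⊨ (φ ∨' ψ)  (rφ , rψ)    ⊨φ∨ψ     =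
    ⊨φ∨ψ (refuted⇒¬⊨ φ rφ , refuted⇒¬⊨ ψ rψ)
  refuted⇒¬⊨ (box A φ) (σ , refute) ⊨[A]φ    =
    ⊨[A]φ (σ , (λ _ _ → tt) , λ { _ (σ′ , _ , extends , refl) →
                                    refuted⇒¬⊨ φ (refute σ′ extends) })

  refuted-merge : ∀ {t} b bs →
    Refuted t (body (merge b bs)) → All (Refuted t ∘ body) (b ∷ bs)
  refuted-merge b []        r        = r ∷ []
  refuted-merge b (b′ ∷ bs) (r , rs) = r ∷ refuted-merge b′ bs rs

  Decision : Formula → Set
  Decision φ = ⊢ φ ⊎ ∃ λ t → Refuted t φ

  -- Conjunctive normal form

  data Literal : Set where
    pos neg : AP → Literal
    modal   : Box → Literal

  literal : Literal → Formula
  literal (pos p)   = var p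
  literal (neg p)   = nvar p
  literal (modal b) = boxed b

  Clause : Set
  Clause = List Literal

  clause : Clause → Formula
  clause = ⋁ ∘ map literal

  cnf : Formula → List Clause
  cnf ⊤'        = []
  cnf ⊥'        = [ [] ]
  cnf (var p)   = [ [ pos p ] ]
  cnf (nvar p)  = [ [ neg p ] ]
  cnf (φ ∧' ψ)  = cnf φ ++ cnf ψ
  cnf (φ ∨' ψ)  = cartesianProductWith _++_ (cnf φ) (cnf ψ)
  cnf (box A φ) = [ [ modal (A ▸ φ) ] ]

  module _ (v : PVal n AP) where

    ⟦_⟧ : List Clause → Bool
    ⟦ cs ⟧ = peval v (⋀ (map clause cs))

    clause-++ : ∀ c d →
      peval v (clause (c ++ d)) ≡ peval v (clause c) ∨ peval v (clause d)
    clause-++ c d =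
      trans (cong (peval v ∘ ⋁) (map-++ literal c d)) (⋁-++ v (map literal c) _)

    ⟦⟧-++ : ∀ cs ds → ⟦ cs ++ ds ⟧ ≡ ⟦ cs ⟧ ∧ ⟦ ds ⟧
    ⟦⟧-++ cs ds =
      trans (cong (peval v ∘ ⋀) (map-++ clause cs ds)) (⋀-++ v (map clause cs) _)

    ⟦⟧-prefix : ∀ c ds → ⟦ map (c ++_) ds ⟧ ≡ peval v (clause c) ∨ ⟦ ds ⟧
    ⟦⟧-prefix c []       = sym (∨-zeroʳ _)
    ⟦⟧-prefix c (d ∷ ds) = begin
      peval v (clause (c ++ d)) ∧ ⟦ map (c ++_) ds ⟧
        ≡⟨ cong₂ _∧_ (clause-++ c d) (⟦⟧-prefix c ds) ⟩
      (peval v (clause c) ∨ peval v (clause d)) ∧ (peval v (clause c) ∨ ⟦ ds ⟧)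
        ≡⟨ sym (∨-distribˡ-∧ (peval v (clause c)) _ _) ⟩
      peval v (clause c) ∨ ⟦ d ∷ ds ⟧ ∎
      where open ≡-Reasoning

    ⟦⟧-cartesian : ∀ cs ds →
      ⟦ cartesianProductWith _++_ cs ds ⟧ ≡ ⟦ cs ⟧ ∨ ⟦ ds ⟧
    ⟦⟧-cartesian []       ds = refl
    ⟦⟧-cartesian (c ∷ cs) ds = begin
      ⟦ map (c ++_) ds ++ cartesianProductWith _++_ cs ds ⟧
        ≡⟨ ⟦⟧-++ (map (c ++_) ds) _ ⟩
      ⟦ map (c ++_) ds ⟧ ∧ ⟦ cartesianProductWith _++_ cs ds ⟧
        ≡⟨ cong₂ _∧_ (⟦⟧-prefix c ds) (⟦⟧-cartesian cs ds) ⟩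
      (peval v (clause c) ∨ ⟦ ds ⟧) ∧ (⟦ cs ⟧ ∨ ⟦ ds ⟧)
        ≡⟨ sym (∨-distribʳ-∧ ⟦ ds ⟧ (peval v (clause c)) ⟦ cs ⟧) ⟩
      ⟦ c ∷ cs ⟧ ∨ ⟦ ds ⟧ ∎
      where open ≡-Reasoning

    ⟦⟧-singleton : ∀ ℓ → ⟦ [ [ ℓ ] ] ⟧ ≡ peval v (literal ℓ)
    ⟦⟧-singleton ℓ = trans (∧-identityʳ _) (∨-identityʳ _)

    ⟦cnf⟧ : ∀ φ → ⟦ cnf φ ⟧ ≡ peval v φ
    ⟦cnf⟧ ⊤'        = refl
    ⟦cnf⟧ ⊥'        = refl
    ⟦cnf⟧ (var p)   = ⟦⟧-singleton (pos p)
    ⟦cnf⟧ (nvar p)  = ⟦⟧-singleton (neg p)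
    ⟦cnf⟧ (φ ∧' ψ)  =
      trans (⟦⟧-++ (cnf φ) (cnf ψ)) (cong₂ _∧_ (⟦cnf⟧ φ) (⟦cnf⟧ ψ))
    ⟦cnf⟧ (φ ∨' ψ)  =
      trans (⟦⟧-cartesian (cnf φ) (cnf ψ)) (cong₂ _∨_ (⟦cnf⟧ φ) (⟦cnf⟧ ψ))
    ⟦cnf⟧ (box A φ) = ⟦⟧-singleton (modal (A ▸ φ))

  ⊢-cnf : ∀ φ → All (⊢_ ∘ clause) (cnf φ) → ⊢ φ
  ⊢-cnf φ ⊢clauses =
    ⊢-mono (λ v → subst (_≡ true) (⟦cnf⟧ v φ)) (⊢-⋀ (All.map⁺ ⊢clauses))

  refuted-cnf : ∀ {t} φ → Any (All (Refuted t ∘ literal)) (cnf φ) → Refuted t φ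
  refuted-cnf ⊤'        ()
  refuted-cnf ⊥'        _               = tt
  refuted-cnf (var p)   (here (r ∷ [])) = r
  refuted-cnf (nvar p)  (here (r ∷ [])) = r
  refuted-cnf (box A φ) (here (r ∷ [])) = r
  refuted-cnf (φ ∧' ψ)  r =
    Sum.map (refuted-cnf φ) (refuted-cnf ψ) (Any.++⁻ (cnf φ) r)
  refuted-cnf (φ ∨' ψ)  r =
    Product.map (refuted-cnf φ) (refuted-cnf ψ)
      (Any.cartesianProductWith⁻ _++_ (λ {c} → All.++⁻ c) (cnf φ) (cnf ψ) r)

  depth-cnf : ∀ {d} φ → depth φ ≤ d → All (All (λ ℓ → depth (literal ℓ) ≤ d)) (cnf φ)
  depth-cnf ⊤'        _  = []
  depth-cnf ⊥'        _  = [] ∷ []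
  depth-cnf (var p)   _  = (z≤n ∷ []) ∷ []
  depth-cnf (nvar p)  _  = (z≤n ∷ []) ∷ []
  depth-cnf (φ ∧' ψ)  ≤d =
    All.++⁺ (depth-cnf φ (m⊔n≤o⇒m≤o _ _ ≤d)) (depth-cnf ψ (m⊔n≤o⇒n≤o _ _ ≤d))
  depth-cnf (φ ∨' ψ)  ≤d =
    All-cartesianProductWith-++⁺ (depth-cnf φ (m⊔n≤o⇒m≤o _ _ ≤d))
                                 (depth-cnf ψ (m⊔n≤o⇒n≤o _ _ ≤d))
  depth-cnf (box A φ) ≤d = (≤d ∷ []) ∷ []

  -- Countermodels for clauses

  _≟neg_ : (p : AP) (ℓ : Literal) → Dec (neg p ≡ ℓ)
  p ≟neg pos _   = no λ ()
  p ≟neg neg q   = map′ (cong neg) (λ { refl → refl }) (p ≟ q)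
  p ≟neg modal _ = no λ ()

  Clash : Clause → Literal → Set
  Clash c (pos p) = neg p ∈ c
  Clash c _       = ⊥

  clash? : ∀ c → Decidable (Clash c)
  clash? c (pos p)   = any? (p ≟neg_) c
  clash? c (neg _)   = no id
  clash? c (modal _) = no id

  ⊢-clash : ∀ c → Any (Clash c) c → ⊢ clause c
  ⊢-clash c clash with find clash
  ... | pos p , p∈c , ¬p∈c = axiom λ v → ⋁-true⁺ v (Any.map⁺ (true-literal v))
    where
    true-literal : ∀ v → Any (λ ℓ → peval v (literal ℓ) ≡ true) c
    true-literal v with PVal.vatom v p in p≡
    ... | true  = lose p∈c p≡
    ... | false = lose ¬p∈c (cong not p≡)

  boxes : Clause → List Box
  boxes []            = []
  boxes (pos _ ∷ c)   = boxes c
  boxes (neg _ ∷ c)   = boxes c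
  boxes (modal b ∷ c) = b ∷ boxes c

  ∈-boxes⁺ : ∀ {b} c → modal b ∈ c → b ∈ boxes c
  ∈-boxes⁺ (pos _ ∷ c)   (there b∈c) = ∈-boxes⁺ c b∈c
  ∈-boxes⁺ (neg _ ∷ c)   (there b∈c) = ∈-boxes⁺ c b∈c
  ∈-boxes⁺ (modal _ ∷ c) (here refl) = here refl
  ∈-boxes⁺ (modal _ ∷ c) (there b∈c) = there (∈-boxes⁺ c b∈c)

  ∈-boxes⁻ : ∀ {b} c → b ∈ boxes c → modal b ∈ c
  ∈-boxes⁻ (pos _ ∷ c)   b∈          = there (∈-boxes⁻ c b∈)
  ∈-boxes⁻ (neg _ ∷ c)   b∈          = there (∈-boxes⁻ c b∈)
  ∈-boxes⁻ (modal _ ∷ c) (here refl) = here refl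
  ∈-boxes⁻ (modal _ ∷ c) (there b∈)  = there (∈-boxes⁻ c b∈)

  ⊑-boxes⇒⊆ : ∀ {bs} c → bs ⊑ boxes c → map boxed bs ⊆ map literal c
  ⊑-boxes⇒⊆ c bs⊑ φ∈ with ∈-map⁻ boxed φ∈
  ... | b , b∈ , refl = ∈-map⁺ literal (∈-boxes⁻ c (⊑-lookup bs⊑ b∈))

  Plays : (Agent n → ℕ) → ℕ → Coalition n → Set
  Plays σ i A = ∀ a → a ∈ₛ A → σ a ≡ i

  plays? : ∀ σ i A → Dec (Plays σ i A)
  plays? σ i A = all? λ a → (a ∈ₛ? A) →-dec (σ a ℕ.≟ i)

  disjoint? : ∀ A B → Dec (Disjoint {n} A B)
  disjoint? A B = all? λ a → (a ∈ₛ? A) →-dec ((a ∈ₛ? B) →-dec no id)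

  position : ∀ {X : Set} {x : X} {xs} → x ∈ xs → ℕ
  position = toℕ ∘ Any.index

  select : (Agent n → ℕ) → ℕ → List Box → List Box
  select σ i []       = []
  select σ i (b ∷ bs) with plays? σ i (coalition b)
  ... | yes _ = b ∷ select σ (suc i) bs
  ... | no  _ = select σ (suc i) bs

  select-⊑ : ∀ σ i bs → select σ i bs ⊑ bs
  select-⊑ σ i []       = []
  select-⊑ σ i (b ∷ bs) with plays? σ i (coalition b)
  ... | yes _ = refl ∷ select-⊑ σ (suc i) bs
  ... | no  _ = b ∷ʳ select-⊑ σ (suc i) bs

  ∈-select : ∀ σ i {b bs} (b∈ : b ∈ bs) →
             Plays σ (i + position b∈) (coalition b) → b ∈ select σ i bs
  ∈-select σ i {bs = b ∷ _} (here refl) plays with plays? σ i (coalition b)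
  ... | yes _     = here refl
  ... | no ¬plays =
    contradiction (subst (λ j → Plays σ j (coalition b)) (+-identityʳ i) plays) ¬plays
  ∈-select σ i {b} {b′ ∷ _} (there b∈) plays with plays? σ i (coalition b′)
  ... | yes _ = there (∈-select σ (suc i) b∈ plays′)
    where plays′ = subst (λ j → Plays σ j (coalition b)) (+-suc i _) plays
  ... | no  _ = ∈-select σ (suc i) b∈ plays′
    where plays′ = subst (λ j → Plays σ j (coalition b)) (+-suc i _) plays

  PlaysAtLeast : (Agent n → ℕ) → ℕ → Box → Set
  PlaysAtLeast σ i b = ∀ a → a ∈ₛ coalition b → i ≤ σ a

  select-≥ : ∀ σ {j} i bs → j ≤ i → All (PlaysAtLeast σ j) (select σ i bs)
  select-≥ σ i []       _   = []
  select-≥ σ i (b ∷ bs) j≤i with plays? σ i (coalition b)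
  ... | yes plays = (λ a a∈ → subst (_ ≤_) (sym (plays a a∈)) j≤i)
                    ∷ select-≥ σ (suc i) bs (m≤n⇒m≤1+n j≤i)
  ... | no  _     = select-≥ σ (suc i) bs (m≤n⇒m≤1+n j≤i)

  select-pairwiseDisjoint : ∀ σ i bs → PairwiseDisjoint (select σ i bs)
  select-pairwiseDisjoint σ i []       = []
  select-pairwiseDisjoint σ i (b ∷ bs) with plays? σ i (coalition b)
  ... | yes plays =
    All.map (λ ≥suc a a∈b a∈b′ → n≮n i (subst (i <_) (plays a a∈b) (≥suc a a∈b′)))
            (select-≥ σ (suc i) bs ≤-refl)
    ∷ select-pairwiseDisjoint σ (suc i) bs
  ... | no  _     = select-pairwiseDisjoint σ (suc i) bs

  FamilyCountermodel : List Box → Set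
  FamilyCountermodel bs = PairwiseDisjoint bs → ∃ λ t → All (Refuted t ∘ body) bs

  Countermodel : Clause → Set
  Countermodel c = ∃ λ t → All (Refuted t ∘ literal) c

  countermodel : ∀ c → ¬ Any (Clash c) c →
                 (∀ {bs} → bs ⊑ boxes c → FamilyCountermodel bs) → Countermodel c
  countermodel c noClash family = root , All.tabulate refute
    where
    child : ∀ σ → ∃ λ t → All (Refuted t ∘ body) (select σ 0 (boxes c))
    child σ = family (select-⊑ σ 0 (boxes c)) (select-pairwiseDisjoint σ 0 (boxes c))

    root : Tree
    root = node (λ p → does (any? (p ≟neg_) c)) (proj₁ ∘ child)

    refute : ∀ {ℓ} → ℓ ∈ c → Refuted root (literal ℓ)
    refute {pos p}   p∈c  = dec-false (any? (p ≟neg_) c) (noClash ∘ lose p∈c)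
    refute {neg p}   ¬p∈c = dec-true (any? (p ≟neg_) c) ¬p∈c
    refute {modal b} b∈c  =
      (λ _ _ → position b∈) ,
      λ σ plays → All.lookup (proj₂ (child σ)) (∈-select σ 0 b∈ plays)
      where b∈ = ∈-boxes⁺ c b∈c

  Oracle : ℕ → Set
  Oracle d =
    ∀ b bs → All (λ b → depth (boxed b) ≤ d) (b ∷ bs) → Decision (body (merge b bs))

  module _ {d} (oracle : Oracle d) where

    tryFamily : ∀ c → All (λ ℓ → depth (literal ℓ) ≤ d) c →
                ∀ {bs} → bs ⊑ boxes c → FamilyCountermodel bs ⊎ ⊢ clause c
    tryFamily c ≤d {[]}     _   = inj₁ λ _ → leaf , []
    tryFamily c ≤d {b ∷ bs} bs⊑
      with allPairs? (λ b b′ → disjoint? (coalition b) (coalition b′)) (b ∷ bs)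
    ... | no ¬disjoint = inj₁ λ disjoint → contradiction disjoint ¬disjoint
    ... | yes disjoint
      with oracle b bs (All.tabulate (All.lookup ≤d ∘ ∈-boxes⁻ c ∘ ⊑-lookup bs⊑))
    ...   | inj₂ (t , r)  = inj₁ λ _ → t , refuted-merge b bs r
    ...   | inj₁ ⊢merged =
      inj₂ (⊢-⋁-⊆ (⊆-trans (⊆-reflexive (++-identityʳ _)) (⊑-boxes⇒⊆ c bs⊑))
             (⊢-unmerge b bs [] disjoint (⊢-⋁⁺ {Γ = [ _ ]} (here refl) (R2 _ ⊢merged))))

    decideClause : ∀ c → All (λ ℓ → depth (literal ℓ) ≤ d) c → ⊢ clause c ⊎ Countermodel c
    decideClause c ≤d with any? (clash? c) c
    ... | yes clash  = inj₁ (⊢-clash c clash)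
    ... | no noClash =
      [ inj₂ ∘ countermodel c noClash , inj₁ ]′ (all-sublists⊎ (boxes c) (tryFamily c ≤d))

    decideWith : ∀ φ → depth φ ≤ d → Decision φ
    decideWith φ ≤d with all⊎any (λ {c} → decideClause c) (depth-cnf φ ≤d)
    ... | inj₁ ⊢clauses = inj₁ (⊢-cnf φ ⊢clauses)
    ... | inj₂ refuted with find refuted
    ...   | _ , c∈ , t , r = inj₂ (t , refuted-cnf φ (lose c∈ r))

  decideBelow : ∀ d φ → depth φ ≤ d → Decision φ
  decideBelow zero    = decideWith λ { _ _ (() ∷ _) }
  decideBelow (suc d) = decideWith λ b bs ≤d →
    decideBelow d (body (merge b bs)) (depth-merge b bs (All.map s≤s⁻¹ ≤d))

  decide : ∀ φ → Decision φ
  decide φ = decideBelow (depth φ) φ ≤-refl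

mainTheorem7 : (n : ℕ) (AP : Set) → AP ↣ ℕ →
    (φ : LI n AP) → Valid φ → ⊢ φ
mainTheorem7 n AP ↣ℕ φ valid =
  fromInj₁ (λ (t , refuted) → ⊥-elim (refuted⇒¬⊨ φ refuted (valid treeModel t))) (decide φ)
  where
  -- Countability of AP is used only to decide equality of atoms.
  open Completeness n (via-injection ↣ℕ ℕ._≟_)
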